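{- Let $L\subseteq\mathcal{L}$ be a finite signature, $a\in\mathbb{A}(L)$, $\mu\in\mathbb{M}(L)$ and $i,i'\in\mathbb{I}(L)$. If $i\xrightarrow{a}i'$ and $\mu\in\sigma_{|L}(i')$, then $a\,\hat{}\,\mu\in\sigma_{|L}(i)$.
   Context: Fix a universe $\mathcal{L}$ of lifelines and a universe $\mathcal{M}$ of messages. For $l\in\mathcal{L}$, $\mathbb{A}_l=\{l!m,\ l?m\mid m\in\mathcal{M}\}$ with $\theta(a)=l$ for $a\in\mathbb{A}_l$, and $\mathbb{T}_l=\mathbb{A}_l^*$. Multi-traces: for finite $L$, $\mathbb{A}(L)=\bigcup_{l\in L}\mathbb{A}_l$ and $\mathbb{M}(L)=\prod_{l\in L}\mathbb{T}_l$, with empty multi-trace $\varepsilon_L$. The multi-trace $a\,\hat{}\,\mu$ is $\mu$ with its $\theta(a)$-component $t$ replaced by $a.t$. Operations on multi-traces: - $\mu_1\cup\mu_2=\{\mu_1,\mu_2\}$. - $\mu_1;\mu_2$ is the componentwise concatenation. - $\mu_1\,||\,\mu_2$ is the set of $\mu$ such that each component of $\mu$ is a shuffle of the corresponding components of $\mu_1$ and $\mu_2$. These are extended to sets via unions over pairs. For $\diamond\in\{;,||\}$, $T^{\diamond*}=\bigcup_{j\ge0}T^{\diamond j}$, with $T^{\diamond0}=\{\varepsilon_L\}$ and $T^{\diamond j}=T\diamond T^{\diamond(j-1)}$. Interactions: $\mathbb{I}(L)$ is the set of ground terms built from $\varnothing$, actions $a\in\mathbb{A}(L)$, the unary operators $loop_S,loop_P$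 and the binary operators $seq,par,alt$. Semantics $\sigma_{|L}$: - $\sigma_{|L}(\varnothing)=\{\varepsilon_L\}$ and $\sigma_{|L}(a)=\{a\,\hat{}\,\varepsilon_L\}$; - $seq$, $par$, $alt$ are interpreted by $;$, $||$, $\cup$; - $loop_S$, $loop_P$ are interpreted by ${}^{;*}$, ${}^{||*}$. Termination predicate $\downarrow$: it is the smallest predicate such that - $\varnothing\downarrow$; - $loop_k(i_1)\downarrow$; - $alt(i_1,i_2)\downarrow$ if $i_1\downarrow$ or $i_2\downarrow$; - $seq(i_1,i_2)\downarrow$ and $par(i_1,i_2)\downarrow$ if both $i_1\downarrow$ and $i_2\downarrow$. Execution relation $\rightarrow\subseteq\mathbb{I}(L)\times\mathbb{A}(L)\times\mathbb{I}(L)$: it is the smallest relation such that - $a\xrightarrow{a}\varnothing$; - if $i_1\xrightarrow{a}i_1'$, then $alt(i_1,i_2)\xrightarrow{a}i_1'$, $par(i_1,i_2)\xrightarrow{a}par(i_1',i_2)$, $seq(i_1,i_2)\xrightarrow{a}seq(i_1',i_2)$, $loop_S(i_1)\xrightarrow{a}seq(i_1',loop_S(i_1))$ and $loop_P(i_1)\xrightarrow{a}par(i_1',loop_P(i_1))$; - if $i_2\xrightarrow{a}i_2'$, then $alt(i_1,i_2)\xrightarrow{a}i_2'$ and $par(i_1,i_2)\xrightarrow{a}par(i_1,i_2')$; - if $i_2\xrightarrow{a}i_2'$ and $i_1\downarrow$, then $seq(i_1,i_2)\xrightarrow{a}i_2'$. -}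

module Defs where

open import Data.Nat using (ℕ; zero; suc)
open import Data.Fin using (Fin)
open import Data.Vec using (Vec; replicate; lookup; updateAt; zipWith)
open import Data.List using (List; []; _∷_; _++_)
open import Data.Product using (_×_; _,_; ∃-syntax)
open import Data.Sum using (_⊎_)
open import Relation.Binary.PropositionalEquality using (_≡_)

-- A finite signature L is represented as Fin n (lifelines l₀ … l_{n-1});
-- messages range over an arbitrary type Msg.

data Dir : Set where
  emit recv : Dir

record Action (n : ℕ) (Msg : Set) : Set where
  constructor act
  field
    θ   : Fin n
    dir : Dir
    msg : Msg

-- local action on lifeline l (lifeline implicit)
LocAct : Set → Set
LocAct Msg = Dir × Msg

MTrace : ℕ → Set → Set
MTrace n Msg = Vec (List (LocAct Msg)) n

ε : ∀ {n Msg} → MTrace n Msg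
ε = replicate _ []

_^_ : ∀ {n Msg} → Action n Msg → MTrace n Msg → MTrace n Msg
act l d m ^ μ = updateAt μ l ((d , m) ∷_)

data Shuffle {A : Set} : List A → List A → List A → Set where
  sh-[] : Shuffle [] [] []
  sh-l  : ∀ {x xs ys zs} → Shuffle xs ys zs → Shuffle (x ∷ xs) ys (x ∷ zs)
  sh-r  : ∀ {y xs ys zs} → Shuffle xs ys zs → Shuffle xs (y ∷ ys) (y ∷ zs)

MSet : ℕ → Set → Set₁
MSet n Msg = MTrace n Msg → Set

module _ {n : ℕ} {Msg : Set} where

  _⨾_ : MTrace n Msg → MTrace n Msg → MTrace n Msg
  μ₁ ⨾ μ₂ = zipWith _++_ μ₁ μ₂

  InPar : MTrace n Msg → MTrace n Msg → MTrace n Msg → Set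
  InPar μ₁ μ₂ μ = ∀ (l : Fin n) → Shuffle (lookup μ₁ l) (lookup μ₂ l) (lookup μ l)

  SeqS : MSet n Msg → MSet n Msg → MSet n Msg
  SeqS T₁ T₂ μ = ∃[ μ₁ ] ∃[ μ₂ ] (T₁ μ₁ × T₂ μ₂ × μ ≡ μ₁ ⨾ μ₂)

  ParS : MSet n Msg → MSet n Msg → MSet n Msg
  ParS T₁ T₂ μ = ∃[ μ₁ ] ∃[ μ₂ ] (T₁ μ₁ × T₂ μ₂ × InPar μ₁ μ₂ μ)

  AltS : MSet n Msg → MSet n Msg → MSet n Msg
  AltS T₁ T₂ μ = T₁ μ ⊎ T₂ μ

  Single : MTrace n Msg → MSet n Msg
  Single μ₀ μ = μ ≡ μ₀

  Pow : (MSet n Msg → MSet n Msg → MSet n Msg) → MSet n Msg → ℕ → MSet n Msg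
  Pow _◇_ T zero    = Single ε
  Pow _◇_ T (suc j) = T ◇ Pow _◇_ T j

  Star : (MSet n Msg → MSet n Msg → MSet n Msg) → MSet n Msg → MSet n Msg
  Star _◇_ T μ = ∃[ j ] Pow _◇_ T j μ

data LoopKind : Set where
  S P : LoopKind

data Interaction (n : ℕ) (Msg : Set) : Set where
  ∅    : Interaction n Msg
  ⟨_⟩  : Action n Msg → Interaction n Msg
  loop : LoopKind → Interaction n Msg → Interaction n Msg
  seq par alt : Interaction n Msg → Interaction n Msg → Interaction n Msg

module _ {n : ℕ} {Msg : Set} where

  σ : Interaction n Msg → MSet n Msg
  σ ∅            = Single ε
  σ ⟨ a ⟩        = Single (a ^ ε)
  σ (loop S i)   = Star SeqS (σ i)
  σ (loop P i)   = Star ParS (σ i)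
  σ (seq i₁ i₂)  = SeqS (σ i₁) (σ i₂)
  σ (par i₁ i₂)  = ParS (σ i₁) (σ i₂)
  σ (alt i₁ i₂)  = AltS (σ i₁) (σ i₂)

  data _↓ : Interaction n Msg → Set where
    ∅↓    : ∅ ↓
    loop↓ : ∀ {k i} → loop k i ↓
    altˡ↓ : ∀ {i₁ i₂} → i₁ ↓ → alt i₁ i₂ ↓
    altʳ↓ : ∀ {i₁ i₂} → i₂ ↓ → alt i₁ i₂ ↓
    seq↓  : ∀ {i₁ i₂} → i₁ ↓ → i₂ ↓ → seq i₁ i₂ ↓
    par↓  : ∀ {i₁ i₂} → i₁ ↓ → i₂ ↓ → par i₁ i₂ ↓

  data _─[_]→_ : Interaction n Msg → Action n Msg → Interaction n Msg → Set where
    ex-act   : ∀ {a} → ⟨ a ⟩ ─[ a ]→ ∅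
    ex-altˡ  : ∀ {a i₁ i₁' i₂} → i₁ ─[ a ]→ i₁' → alt i₁ i₂ ─[ a ]→ i₁'
    ex-parˡ  : ∀ {a i₁ i₁' i₂} → i₁ ─[ a ]→ i₁' → par i₁ i₂ ─[ a ]→ par i₁' i₂
    ex-seqˡ  : ∀ {a i₁ i₁' i₂} → i₁ ─[ a ]→ i₁' → seq i₁ i₂ ─[ a ]→ seq i₁' i₂
    ex-loopS : ∀ {a i₁ i₁'} → i₁ ─[ a ]→ i₁' → loop S i₁ ─[ a ]→ seq i₁' (loop S i₁)
    ex-loopP : ∀ {a i₁ i₁'} → i₁ ─[ a ]→ i₁' → loop P i₁ ─[ a ]→ par i₁' (loop P i₁)
    ex-altʳ  : ∀ {a i₁ i₂ i₂'} → i₂ ─[ a ]→ i₂' → alt i₁ i₂ ─[ a ]→ i₂'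
    ex-parʳ  : ∀ {a i₁ i₂ i₂'} → i₂ ─[ a ]→ i₂' → par i₁ i₂ ─[ a ]→ par i₁ i₂'
    ex-seqʳ  : ∀ {a i₁ i₂ i₂'} → i₂ ─[ a ]→ i₂' → i₁ ↓ → seq i₁ i₂ ─[ a ]→ i₂'

{-# OPTIONS --safe #-}
-- Prefixing a only touches the component θ(a),
-- so it commutes with concatenation in the left operand and with shuffling in either
-- operand; a step of a loop is matched by one more iteration of the unfolded loop; and the
-- rule that skips a terminated left operand of seq uses that a terminating interaction
-- accepts the empty multi-trace.
module Submission where

open import Defs
open import Data.Nat using (ℕ; suc)
open import Data.Fin using (zero; suc)
open import Data.Vec using (Vec; _∷_; lookup; updateAt; zipWith)
open import Data.Vec.Properties using (zipWith-identityˡ; lookup-replicate)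
open import Data.List using ([])
open import Data.List.Properties using (++-identityˡ)
open import Data.Product using (_,_)
open import Data.Sum using (inj₁; inj₂)
open import Relation.Binary.PropositionalEquality using (_≡_; refl; sym; cong; subst)

module _ {n : ℕ} {A B C : Set} where

  Pointwise₃ : (A → B → C → Set) → Vec A n → Vec B n → Vec C n → Set
  Pointwise₃ R xs ys zs = ∀ l → R (lookup xs l) (lookup ys l) (lookup zs l)

updateAt-zipWith : ∀ {n} {A B C : Set} {f : A → B → C} {g : A → A} {h : C → C} →
                   (∀ x y → h (f x y) ≡ f (g x) y) →
                   ∀ (xs : Vec A n) ys l →
                   updateAt (zipWith f xs ys) l h ≡ zipWith f (updateAt xs l g) ys
updateAt-zipWith h-f (x ∷ xs) (y ∷ ys) zero    = cong (_∷ _) (h-f x y)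
updateAt-zipWith h-f (x ∷ xs) (y ∷ ys) (suc l) = cong (_ ∷_) (updateAt-zipWith h-f xs ys l)

updateAt-pointwise₃ : ∀ {n} {A B C : Set} (R : A → B → C → Set) {f : A → A} {h : C → C} →
                      (∀ {x y z} → R x y z → R (f x) y (h z)) →
                      ∀ (xs : Vec A n) ys zs → Pointwise₃ R xs ys zs →
                      ∀ l → Pointwise₃ R (updateAt xs l f) ys (updateAt zs l h)
updateAt-pointwise₃ R Rfh (_ ∷ _) (_ ∷ _) (_ ∷ _) p zero    zero     = Rfh (p zero)
updateAt-pointwise₃ R Rfh (_ ∷ _) (_ ∷ _) (_ ∷ _) p zero    (suc l') = p (suc l')
updateAt-pointwise₃ R Rfh (_ ∷ _) (_ ∷ _) (_ ∷ _) p (suc l) zero     = p zero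
updateAt-pointwise₃ R Rfh (_ ∷ xs) (_ ∷ ys) (_ ∷ zs) p (suc l) (suc l') =
  updateAt-pointwise₃ R Rfh xs ys zs (λ j → p (suc j)) l l'

module _ {n : ℕ} {Msg : Set} where

  ε-⨾-identityˡ : (μ : MTrace n Msg) → ε ⨾ μ ≡ μ
  ε-⨾-identityˡ = zipWith-identityˡ ++-identityˡ

  ε-InPar : InPar {n} {Msg} ε ε ε
  ε-InPar l = subst (λ t → Shuffle t t t) (sym (lookup-replicate l [])) sh-[]

  ^-⨾-distribˡ : (a : Action n Msg) (μ₁ μ₂ : MTrace n Msg) → a ^ (μ₁ ⨾ μ₂) ≡ (a ^ μ₁) ⨾ μ₂
  ^-⨾-distribˡ (act l d m) μ₁ μ₂ = updateAt-zipWith (λ _ _ → refl) μ₁ μ₂ l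

  ^-InParˡ : ∀ (a : Action n Msg) μ₁ μ₂ μ → InPar μ₁ μ₂ μ → InPar (a ^ μ₁) μ₂ (a ^ μ)
  ^-InParˡ (act l _ _) μ₁ μ₂ μ p = updateAt-pointwise₃ Shuffle sh-l μ₁ μ₂ μ p l

  ^-InParʳ : ∀ (a : Action n Msg) μ₁ μ₂ μ → InPar μ₁ μ₂ μ → InPar μ₁ (a ^ μ₂) (a ^ μ)
  ^-InParʳ (act l _ _) μ₁ μ₂ μ p = updateAt-pointwise₃ (λ y x z → Shuffle x y z) sh-r μ₂ μ₁ μ p l

  ↓⇒ε∈σ : ∀ {i : Interaction n Msg} → i ↓ → σ i ε
  ↓⇒ε∈σ ∅↓             = refl
  ↓⇒ε∈σ (loop↓ {S})    = 0 , refl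
  ↓⇒ε∈σ (loop↓ {P})    = 0 , refl
  ↓⇒ε∈σ (altˡ↓ t)      = inj₁ (↓⇒ε∈σ t)
  ↓⇒ε∈σ (altʳ↓ t)      = inj₂ (↓⇒ε∈σ t)
  ↓⇒ε∈σ (seq↓ t₁ t₂)   = ε , ε , ↓⇒ε∈σ t₁ , ↓⇒ε∈σ t₂ , sym (ε-⨾-identityˡ ε)
  ↓⇒ε∈σ (par↓ t₁ t₂)   = ε , ε , ↓⇒ε∈σ t₁ , ↓⇒ε∈σ t₂ , ε-InPar

  ─→-σ-prefix : ∀ {a : Action n Msg} {μ i i'} → i ─[ a ]→ i' → σ i' μ → σ i (a ^ μ)
  ─→-σ-prefix ex-act refl = refl
  ─→-σ-prefix (ex-altˡ e) h = inj₁ (─→-σ-prefix e h)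
  ─→-σ-prefix (ex-altʳ e) h = inj₂ (─→-σ-prefix e h)
  ─→-σ-prefix {a} {μ} (ex-parˡ e) (μ₁ , μ₂ , h₁ , h₂ , p) =
    a ^ μ₁ , μ₂ , ─→-σ-prefix e h₁ , h₂ , ^-InParˡ a μ₁ μ₂ μ p
  ─→-σ-prefix {a} {μ} (ex-parʳ e) (μ₁ , μ₂ , h₁ , h₂ , p) =
    μ₁ , a ^ μ₂ , h₁ , ─→-σ-prefix e h₂ , ^-InParʳ a μ₁ μ₂ μ p
  ─→-σ-prefix {a} (ex-seqˡ e) (μ₁ , μ₂ , h₁ , h₂ , refl) =
    a ^ μ₁ , μ₂ , ─→-σ-prefix e h₁ , h₂ , ^-⨾-distribˡ a μ₁ μ₂
  ─→-σ-prefix {a} {μ} (ex-seqʳ e t) h =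
    ε , a ^ μ , ↓⇒ε∈σ t , ─→-σ-prefix e h , sym (ε-⨾-identityˡ (a ^ μ))
  ─→-σ-prefix {a} (ex-loopS e) (μ₁ , μ₂ , h₁ , (j , h₂) , refl) =
    suc j , a ^ μ₁ , μ₂ , ─→-σ-prefix e h₁ , h₂ , ^-⨾-distribˡ a μ₁ μ₂
  ─→-σ-prefix {a} {μ} (ex-loopP e) (μ₁ , μ₂ , h₁ , (j , h₂) , p) =
    suc j , a ^ μ₁ , μ₂ , ─→-σ-prefix e h₁ , h₂ , ^-InParˡ a μ₁ μ₂ μ p

lemma2 : (n : ℕ) (Msg : Set) (a : Action n Msg) (μ : MTrace n Msg)
         (i i' : Interaction n Msg) →
         i ─[ a ]→ i' → σ i' μ → σ i (a ^ μ)
lemma2 _ _ _ _ _ _ = ─→-σ-prefix
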